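{- Let $G$ be a connected finite $\delta$-hyperbolic graph, and let $z$ be a vertex, $x\in F(z)$ and $y\in F(x)$. Every vertex $c\in S_{\lfloor d(x,y)/2\rfloor}(x,y)$ satisfies $e(c)\le rad(G)+3\delta$ and $e(c)\le\lceil d(x,y)/2\rceil+4\delta$.
   Context: $G$ is $\delta$-hyperbolic if for any four vertices $u,v,w,x$ the two larger of $d(u,v)+d(w,x)$, $d(u,w)+d(v,x)$, $d(u,x)+d(v,w)$ differ by at most $2\delta$ ($d$ = shortest-path distance). $e(v)=\max_u d(v,u)$, $F(v)=\{u: d(u,v)=e(v)\}$, $rad(G)=\min_v e(v)$. $I(x,y)=\{w: d(x,w)+d(w,y)=d(x,y)\}$, $S_k(x,y)=\{v\in I(x,y): d(v,x)=k\}$. -}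

module Defs where

open import Data.Nat using (ℕ; zero; suc; _+_; _*_; _≤_; _⊔_; _⊓_; ⌊_/2⌋; ⌈_/2⌉)
open import Data.Fin using (Fin)
open import Data.List using (List; foldr; map)
open import Data.List.Base using (allFin)
open import Data.Product using (_×_)
open import Relation.Binary.PropositionalEquality using (_≡_)
open import Relation.Nullary using (¬_)
open import Level using (0ℓ)

record Graph (n : ℕ) : Set₁ where
  field
    Adj   : Fin n → Fin n → Set
    sym   : ∀ {u v} → Adj u v → Adj v u
    irref : ∀ {u} → ¬ Adj u u

module _ {n : ℕ} (G : Graph n) where
  open Graph G

  data Walk : Fin n → Fin n → ℕ → Set where
    here : ∀ {u} → Walk u u 0
    step : ∀ {u w v k} → Adj u w → Walk w v k → Walk u v (suc k)

  -- d is the shortest-path distance of G: for every u v there is a walk of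
  -- length d u v and every walk from u to v has length ≥ d u v.
  -- (Existence of such d for all pairs is exactly connectedness of G.)
  IsDistance : (Fin n → Fin n → ℕ) → Set
  IsDistance d = ∀ u v → Walk u v (d u v) × (∀ k → Walk u v k → d u v ≤ k)

max3 : ℕ → ℕ → ℕ → ℕ
max3 a b c = a ⊔ b ⊔ c

mid3 : ℕ → ℕ → ℕ → ℕ
mid3 a b c = (a ⊓ b) ⊔ (b ⊓ c) ⊔ (a ⊓ c)

module _ {n : ℕ} (d : Fin n → Fin n → ℕ) where

  -- δ-hyperbolicity with h = 2δ: the two larger of the three pair sums differ by ≤ h.
  Hyperbolic2 : ℕ → Set
  Hyperbolic2 h = ∀ u v w x →
    let s₁ = d u v + d w x
        s₂ = d u w + d v x
        s₃ = d u x + d v w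
    in max3 s₁ s₂ s₃ ≤ mid3 s₁ s₂ s₃ + h

  ecc : Fin n → ℕ
  ecc v = foldr _⊔_ 0 (map (d v) (allFin n))

  InF : Fin n → Fin n → Set
  InF v u = d u v ≡ ecc v

  InI : Fin n → Fin n → Fin n → Set
  InI x y w = d x w + d w y ≡ d x y

  InS : ℕ → Fin n → Fin n → Fin n → Set
  InS k x y v = InI x y v × d v x ≡ k

rad : {m : ℕ} → (Fin (suc m) → Fin (suc m) → ℕ) → ℕ
rad {m} d = foldr _⊓_ (ecc d Fin.zero) (map (ecc d) (allFin (suc m)))

module Submission where

-- Write h = 2δ.  For every vertex v, the four-point condition on c, v, x, y together with
-- c ∈ I(x,y) gives d(c,v) + d(c,y) ≤ d(v,y) + h or d(c,v) + d(c,x) ≤ d(v,x) + h.  As y is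
-- farthest from x, d(v,x) ≤ d(x,y); as x is farthest from z, the four-point condition on
-- z, x, v, y gives d(v,y) ≤ d(x,y) + h.  With d(c,x) = ⌊d(x,y)/2⌋, d(c,y) = ⌈d(x,y)/2⌉ and
-- all distances at most 2 rad(G), either case yields d(c,v) ≤ ⌈d(x,y)/2⌉ + 2h and
-- d(c,v) + ⌈d(x,y)/2⌉ ≤ 2 rad(G) + h; adding the two bounds gives the radius estimate.

open import Defs
open import Data.Nat using (ℕ; suc; _+_; _*_; _≤_; _⊔_; ⌊_/2⌋; ⌈_/2⌉; z≤n)
open import Data.Nat.Properties
open import Data.Nat.Tactic.RingSolver using (solve)
open import Data.Fin using (Fin)
open import Function using (_∘_)
open import Data.Product using (_×_; _,_; proj₁; proj₂; ∃)
open import Data.Sum using (_⊎_; inj₁; inj₂; [_,_]) renaming (map to map-⊎)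
open import Data.List using ([]; _∷_; map)
open import Data.List.Base using (allFin)
open import Data.List.Properties using (foldr-preservesᵇ; foldr-preservesᵒ)
import Data.List.Relation.Unary.All as All
import Data.List.Relation.Unary.All.Properties as All
import Data.List.Relation.Unary.Any as Any
open import Data.List.Membership.Propositional.Properties
  using (∈-allFin; ∈-map⁺; ∈-map⁻; foldr-selective)
open import Relation.Binary.PropositionalEquality
  using (_≡_; sym; trans; cong; subst; subst₂)

open ≤-Reasoning

+-cancel-shared : ∀ e p q t h → e + (p + q) ≤ p + t + h → e + q ≤ t + h
+-cancel-shared e p q t h e+p+q≤ = +-cancelˡ-≤ p (e + q) (t + h) (begin
  p + (e + q) ≡⟨ solve (e ∷ p ∷ q ∷ []) ⟩
  e + (p + q) ≤⟨ e+p+q≤ ⟩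
  p + t + h   ≡⟨ +-assoc p t h ⟩
  p + (t + h) ∎)

+-cancel-dominated : ∀ {s t p q u h} → s + t ≤ p + q + h → p ≤ s → q ≤ u → t ≤ u + h
+-cancel-dominated {s} {t} {p} {q} {u} {h} s+t≤ p≤s q≤u = +-cancelˡ-≤ s t (u + h) (begin
  s + t       ≤⟨ s+t≤ ⟩
  p + q + h   ≤⟨ +-monoˡ-≤ h (+-mono-≤ p≤s q≤u) ⟩
  s + u + h   ≡⟨ +-assoc s u h ⟩
  s + (u + h) ∎)

≤⊔+⇒≤+⊎≤+ : ∀ {s} p q h → s ≤ p ⊔ q + h → s ≤ p + h ⊎ s ≤ q + h
≤⊔+⇒≤+⊎≤+ {s} p q h s≤p⊔q+h with ⊔-sel p q
... | inj₁ p⊔q≡p = inj₁ (subst (λ t → s ≤ t + h) p⊔q≡p s≤p⊔q+h)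
... | inj₂ p⊔q≡q = inj₂ (subst (λ t → s ≤ t + h) p⊔q≡q s≤p⊔q+h)

mid3≤⊔ : ∀ s₁ s₂ s₃ → mid3 s₁ s₂ s₃ ≤ s₂ ⊔ s₃
mid3≤⊔ s₁ s₂ s₃ = ⊔-lub (⊔-lub (≤-trans (m⊓n≤n s₁ s₂) (m≤m⊔n s₂ s₃))
                               (≤-trans (m⊓n≤m s₂ s₃) (m≤m⊔n s₂ s₃)))
                        (≤-trans (m⊓n≤n s₁ s₃) (m≤n⊔m s₂ s₃))

centre-via-far-end : ∀ {e a b t h r} → e + b ≤ t + h → t ≤ a + b + h → t ≤ r + r → a ≤ b →
                     e ≤ b + 2 * h × e + b ≤ r + r + h
centre-via-far-end {e} {a} {b} {t} {h} {r} e+b≤t+h t≤a+b+h t≤r+r a≤b =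
  ≤-trans e≤a+2h (+-monoˡ-≤ (2 * h) a≤b) , ≤-trans e+b≤t+h (+-monoˡ-≤ h t≤r+r)
  where
  e≤a+2h : e ≤ a + 2 * h
  e≤a+2h = +-cancelʳ-≤ b e (a + 2 * h) (begin
    e + b         ≤⟨ e+b≤t+h ⟩
    t + h         ≤⟨ +-monoˡ-≤ h t≤a+b+h ⟩
    a + b + h + h ≡⟨ solve (a ∷ b ∷ h ∷ []) ⟩
    a + 2 * h + b ∎)

centre-via-near-end : ∀ {e a b s h r} → e + a ≤ s + h → s ≤ a + b → b ≤ r →
                      e ≤ b + 2 * h × e + b ≤ r + r + h
centre-via-near-end {e} {a} {b} {s} {h} {r} e+a≤s+h s≤a+b b≤r =
  ≤-trans e≤b+h (+-monoʳ-≤ b (m≤m+n h (h + 0))) , (begin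
    e + b     ≤⟨ +-monoˡ-≤ b e≤b+h ⟩
    b + h + b ≡⟨ solve (b ∷ h ∷ []) ⟩
    b + b + h ≤⟨ +-monoˡ-≤ h (+-mono-≤ b≤r b≤r) ⟩
    r + r + h ∎)
  where
  e≤b+h : e ≤ b + h
  e≤b+h = +-cancelʳ-≤ a e (b + h) (begin
    e + a     ≤⟨ e+a≤s+h ⟩
    s + h     ≤⟨ +-monoˡ-≤ h s≤a+b ⟩
    a + b + h ≡⟨ solve (a ∷ b ∷ h ∷ []) ⟩
    b + h + a ∎)

doubled-centre-bounds : ∀ {e b r h} → e ≤ b + 2 * h → e + b ≤ r + r + h →
                        2 * e ≤ 2 * r + 3 * h × 2 * e ≤ 2 * b + 4 * h
doubled-centre-bounds {e} {b} {r} {h} e≤b+2h e+b≤r+r+h = (begin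
    2 * e             ≡⟨ solve (e ∷ []) ⟩
    e + e             ≤⟨ +-monoʳ-≤ e e≤b+2h ⟩
    e + (b + 2 * h)   ≡⟨ solve (e ∷ b ∷ h ∷ []) ⟩
    e + b + 2 * h     ≤⟨ +-monoˡ-≤ (2 * h) e+b≤r+r+h ⟩
    r + r + h + 2 * h ≡⟨ solve (r ∷ h ∷ []) ⟩
    2 * r + 3 * h     ∎) , (begin
    2 * e             ≤⟨ *-monoʳ-≤ 2 e≤b+2h ⟩
    2 * (b + 2 * h)   ≡⟨ solve (b ∷ h ∷ []) ⟩
    2 * b + 4 * h     ∎)

four-point : ∀ {n} (d : Fin n → Fin n → ℕ) {h} → Hyperbolic2 d h → ∀ u v w x →
  d u v + d w x ≤ d u w + d v x + h ⊎ d u v + d w x ≤ d u x + d v w + h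
four-point d {h} hyp u v w x = ≤⊔+⇒≤+⊎≤+ s₂ s₃ h (begin
  s₁                ≤⟨ ≤-trans (m≤m⊔n s₁ s₂) (m≤m⊔n (s₁ ⊔ s₂) s₃) ⟩
  max3 s₁ s₂ s₃     ≤⟨ hyp u v w x ⟩
  mid3 s₁ s₂ s₃ + h ≤⟨ +-monoˡ-≤ h (mid3≤⊔ s₁ s₂ s₃) ⟩
  s₂ ⊔ s₃ + h       ∎)
  where
  s₁ = d u v + d w x
  s₂ = d u w + d v x
  s₃ = d u x + d v w

module _ {n : ℕ} (d : Fin n → Fin n → ℕ) where

  dist≤ecc : ∀ v u → d v u ≤ ecc d v
  dist≤ecc v u = foldr-preservesᵒ
    (λ s t → [ (λ p → ≤-trans p (m≤m⊔n s t)) , (λ p → ≤-trans p (m≤n⊔m s t)) ])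
    0 _ (inj₂ (Any.map ≤-reflexive (∈-map⁺ (d v) (∈-allFin u))))

  *-ecc≤ : ∀ k v {K} → (∀ u → k * d v u ≤ K) → k * ecc d v ≤ K
  *-ecc≤ k v {K} bound = foldr-preservesᵇ {P = λ t → k * t ≤ K} *-⊔≤
    (≤-trans (≤-reflexive (*-zeroʳ k)) z≤n)
    (All.map⁺ {xs = allFin n} (All.tabulate (λ {u} _ → bound u)))
    where
    *-⊔≤ : ∀ {s t} → k * s ≤ K → k * t ≤ K → k * (s ⊔ t) ≤ K
    *-⊔≤ {s} {t} p q = subst (_≤ K) (sym (*-distribˡ-⊔ k s t)) (⊔-lub p q)

rad-attained : ∀ {m} (d : Fin (suc m) → Fin (suc m) → ℕ) → ∃ λ c → rad d ≡ ecc d c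
rad-attained {m} d with foldr-selective ⊓-sel (ecc d Fin.zero) (map (ecc d) (allFin (suc m)))
... | inj₁ rad≡ecc₀ = Fin.zero , rad≡ecc₀
... | inj₂ rad∈eccs with ∈-map⁻ (ecc d) rad∈eccs
...   | c , _ , rad≡ecc = c , rad≡ecc

module _ {n : ℕ} (G : Graph n) where
  open Graph G renaming (sym to Adj-sym)

  _++ʷ_ : ∀ {u w v k l} → Walk G u w k → Walk G w v l → Walk G u v (k + l)
  here     ++ʷ q = q
  step e p ++ʷ q = step e (p ++ʷ q)

  reverseʷ : ∀ {u v k} → Walk G u v k → Walk G v u k
  reverseʷ here = here
  reverseʷ {u} {v} (step {k = k} e p) =
    subst (Walk G v u) (+-comm k 1) (reverseʷ p ++ʷ step (Adj-sym e) here)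

  module _ {d : Fin n → Fin n → ℕ} (isDist : IsDistance G d) where

    shortest : ∀ u v → Walk G u v (d u v)
    shortest u v = proj₁ (isDist u v)

    dist-minimal : ∀ {u v k} → Walk G u v k → d u v ≤ k
    dist-minimal {u} {v} = proj₂ (isDist u v) _

    dist-triangle : ∀ u w v → d u v ≤ d u w + d w v
    dist-triangle u w v = dist-minimal (shortest u w ++ʷ shortest w v)

    dist-sym : ∀ u v → d u v ≡ d v u
    dist-sym u v = ≤-antisym (dist-minimal (reverseʷ (shortest v u)))
                             (dist-minimal (reverseʷ (shortest u v)))

    dist≤dist-to-far : ∀ {z x} → InF d z x → ∀ v → d z v ≤ d z x
    dist≤dist-to-far {z} {x} x∈Fz v =
      subst (d z v ≤_) (trans (sym x∈Fz) (dist-sym x z)) (dist≤ecc d z v)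

    slice⌊/2⌋-dist : ∀ {x y c} → InS d ⌊ d x y /2⌋ x y c → d c y ≡ ⌈ d x y /2⌉
    slice⌊/2⌋-dist {x} {y} {c} (c∈I , cx≡a) = +-cancelˡ-≡ ⌊ d x y /2⌋ (d c y) ⌈ d x y /2⌉
      (trans (cong (_+ d c y) (trans (sym cx≡a) (dist-sym c x)))
             (trans c∈I (sym (⌊n/2⌋+⌈n/2⌉≡n (d x y)))))

    module _ {h : ℕ} (hyp : Hyperbolic2 d h) where

      interval-four-point : ∀ {x y c} → InI d x y c → ∀ v →
        d c v + d c y ≤ d v y + h ⊎ d c v + d c x ≤ d v x + h
      interval-four-point {x} {y} {c} c∈I v = map-⊎
        (λ viaY → +-cancel-shared (d c v) (d c x) (d c y) (d v y) h
          (subst (λ D → d c v + D ≤ d c x + d v y + h) xy≡cx+cy viaY))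
        (λ viaX → +-cancel-shared (d c v) (d c y) (d c x) (d v x) h
          (subst (λ D → d c v + D ≤ d c y + d v x + h)
                 (trans xy≡cx+cy (+-comm (d c x) (d c y))) viaX))
        (four-point d hyp c v x y)
        where
        xy≡cx+cy : d x y ≡ d c x + d c y
        xy≡cx+cy = trans (sym c∈I) (cong (_+ d c y) (dist-sym x c))

      dist-to-far-of-far : ∀ {z x y} → InF d z x → InF d x y → ∀ v → d v y ≤ d x y + h
      dist-to-far-of-far {z} {x} {y} x∈Fz y∈Fx v with four-point d hyp z x v y
      ... | inj₁ viaV = +-cancel-dominated viaV (dist≤dist-to-far x∈Fz v) ≤-refl
      ... | inj₂ viaY = +-cancel-dominated viaY (dist≤dist-to-far x∈Fz y) (dist≤dist-to-far y∈Fx v)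

module _ {m : ℕ} (G : Graph (suc m)) {d : Fin (suc m) → Fin (suc m) → ℕ}
         (isDist : IsDistance G d) where

  dist≤rad+rad : ∀ u v → d u v ≤ rad d + rad d
  dist≤rad+rad u v with rad-attained d
  ... | c , rad≡ecc rewrite rad≡ecc =
    ≤-trans (dist-triangle G isDist u c v)
            (+-mono-≤ (subst (_≤ ecc d c) (dist-sym G isDist c u) (dist≤ecc d c u))
                      (dist≤ecc d c v))

  ⌈dist/2⌉≤rad : ∀ u v → ⌈ d u v /2⌉ ≤ rad d
  ⌈dist/2⌉≤rad u v = subst (⌈ d u v /2⌉ ≤_) (sym (n≡⌈n+n/2⌉ (rad d)))
                            (⌈n/2⌉-mono (dist≤rad+rad u v))

  midpoint-bound : ∀ {h} → Hyperbolic2 d h → ∀ {z x y c} →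
    InF d z x → InF d x y → InS d ⌊ d x y /2⌋ x y c →
    ∀ v → d c v ≤ ⌈ d x y /2⌉ + 2 * h × d c v + ⌈ d x y /2⌉ ≤ rad d + rad d + h
  midpoint-bound {h} hyp {z} {x} {y} {c} x∈Fz y∈Fx c∈S@(c∈I , cx≡a) v =
    [ (λ viaY → centre-via-far-end {r = rad d}
         (subst (λ b → d c v + b ≤ d v y + h) (slice⌊/2⌋-dist G isDist c∈S) viaY)
         vy≤a+b+h (dist≤rad+rad v y) (⌊n/2⌋≤⌈n/2⌉ (d x y)))
    , (λ viaX → centre-via-near-end {r = rad d}
         (subst (λ a → d c v + a ≤ d v x + h) cx≡a viaX)
         vx≤a+b (⌈dist/2⌉≤rad x y))
    ] (interval-four-point G isDist hyp c∈I v)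
    where
    xy≡a+b : d x y ≡ ⌊ d x y /2⌋ + ⌈ d x y /2⌉
    xy≡a+b = sym (⌊n/2⌋+⌈n/2⌉≡n (d x y))
    vy≤a+b+h : d v y ≤ ⌊ d x y /2⌋ + ⌈ d x y /2⌉ + h
    vy≤a+b+h = subst (λ D → d v y ≤ D + h) xy≡a+b (dist-to-far-of-far G isDist hyp x∈Fz y∈Fx v)
    vx≤a+b : d v x ≤ ⌊ d x y /2⌋ + ⌈ d x y /2⌉
    vx≤a+b = subst₂ _≤_ (dist-sym G isDist x v) xy≡a+b (dist≤dist-to-far G isDist y∈Fx v)

corollary32 : (m : ℕ) (G : Graph (suc m)) (d : Fin (suc m) → Fin (suc m) → ℕ) →
    IsDistance G d → (h : ℕ) → Hyperbolic2 d h →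
    (z x y c : Fin (suc m)) → InF d z x → InF d x y →
    InS d ⌊ d x y /2⌋ x y c →
    (2 * ecc d c ≤ 2 * rad d + 3 * h) × (2 * ecc d c ≤ 2 * ⌈ d x y /2⌉ + 4 * h)
corollary32 m G d isDist h hyp z x y c x∈Fz y∈Fx c∈S =
  *-ecc≤ d 2 c (proj₁ ∘ doubled) , *-ecc≤ d 2 c (proj₂ ∘ doubled)
  where
  doubled : ∀ v → 2 * d c v ≤ 2 * rad d + 3 * h × 2 * d c v ≤ 2 * ⌈ d x y /2⌉ + 4 * h
  doubled v with midpoint-bound G isDist hyp x∈Fz y∈Fx c∈S v
  ... | near , far = doubled-centre-bounds {r = rad d} near far
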